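{- Let $n\ge 3$ and let $P(G(n))$ be the power graph of the gyrogroup $(G(n),\oplus)$ described in the context. Then its reciprocal status Hosoya polynomial is $$H_{rs}(P(G(n)),x)=(2^{n-1}-1)x^{\frac{2^{n+2}-2^{n-1}-4}{2}}+2^{n-1}x^{2^n+2^{n-1}-1}+\binom{2^{n-1}-1}{2}x^{2^n+2^{n-1}-2}.$$
   Context: Let $n\ge 3$ and $m=2^{n-1}$. Put $P(n)=\{0,1,\dots,m-1\}$, $H(n)=\{m,m+1,\dots,2^n-1\}$ and $G(n)=P(n)\cup H(n)$. Define a binary operation $\oplus$ on $G(n)$ by: $i\oplus j=t$ if $(i,j)\in P(n)\times P(n)$; $i\oplus j=t+m$ if $(i,j)\in P(n)\times H(n)$; $i\oplus j=s+m$ if $(i,j)\in H(n)\times P(n)$; $i\oplus j=k$ if $(i,j)\in H(n)\times H(n)$, where $t,s,k\in P(n)$ are determined by $t\equiv i+j$, $s\equiv i+(\tfrac m2-1)j$, $k\equiv(\tfrac m2+1)i+(\tfrac m2-1)j \pmod m$. Then $(G(n),\oplus)$ is a gyrogroup with identity $e=0$. Powers are defined by $a^1=a$, $a^{k+1}=a\oplus a^k$. The power graph $P(G(n))$ is the simple undirected graph with vertex set $G(n)$ in which two distinct vertices $u,v$ are adjacent if and only if $u^k=v$ or $v^k=u$ for some positive integer $k$. For a connected graph $G$ with shortest-path distance $d$, the reciprocal status of a vertex $v$ is $rs(v)=\sum_{u\in V(G),u\ne v}\frac{1}{d(u,v)}$, and the reciprocal status Hosoya polynomial is $H_{rs}(G,x)=\sum_{uv\in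 E(G)}x^{rs(u)+rs(v)}$, the sum over all edges. -}

module Defs where

open import Data.Nat using (ℕ; zero; suc; _+_; _*_; _∸_; _^_; _≤_; _<_; _<?_; NonZero)
open import Data.Nat.Properties using (m^n≢0)
import Data.Nat.Properties as ℕP
open import Data.Nat.DivMod using (_%_; _/_)
open import Data.Nat.Combinatorics using (_C_)
open import Data.Integer using (+_)
open import Data.Rational using (ℚ; 0ℚ) renaming (_+_ to _+ℚ_; _/_ to _/ℚ_)
import Data.Rational.Properties as ℚP
open import Data.List using (List; []; _∷_; upTo; concatMap; foldr)
open import Data.Product using (_×_; _,_; ∃)
open import Data.Sum using (_⊎_)
open import Data.Bool using (if_then_else_)
open import Relation.Nullary using (Dec; yes; no; ¬_)
open import Relation.Nullary.Decidable using (⌊_⌋)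
open import Relation.Binary.PropositionalEquality using (_≡_; _≢_)

half : ℕ → ℕ
half n = 2 ^ (n ∸ 1)

half-nonZero : ∀ n → NonZero (half n)
half-nonZero n = m^n≢0 2 (n ∸ 1)

modm : ℕ → ℕ → ℕ
modm n x = _%_ x (half n) {{half-nonZero n}}

-- i ⊕ j, following the four cases of the definition (P(n) = [0,m), H(n) = [m,2^n))
gyro : (n : ℕ) → ℕ → ℕ → ℕ
gyro n i j with i <? half n | j <? half n
... | yes _ | yes _ = modm n (i + j)
... | yes _ | no  _ = modm n (i + j) + half n
... | no  _ | yes _ = modm n (i + ((half n / 2) ∸ 1) * j) + half n
... | no  _ | no  _ = modm n (((half n / 2) + 1) * i + ((half n / 2) ∸ 1) * j)

-- powS n a k = a^(k+1), with a^1 = a and a^(k+1) = a ⊕ a^k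
powS : (n : ℕ) → ℕ → ℕ → ℕ
powS n a zero    = a
powS n a (suc k) = gyro n a (powS n a k)

Vertex : ℕ → ℕ → Set
Vertex n u = u < 2 ^ n

Adj : ℕ → ℕ → ℕ → Set
Adj n u v = Vertex n u × Vertex n v × u ≢ v ×
            ((∃ λ k → powS n u k ≡ v) ⊎ (∃ λ k → powS n v k ≡ u))

data Walk (n : ℕ) : ℕ → ℕ → ℕ → Set where
  here : ∀ {u} → Vertex n u → Walk n u u 0
  step : ∀ {u w v ℓ} → Adj n u w → Walk n w v ℓ → Walk n u v (suc ℓ)

IsDistance : (n : ℕ) → (ℕ → ℕ → ℕ) → Set
IsDistance n d = ∀ u v → Vertex n u → Vertex n v →
  Walk n u v (d u v) × (∀ ℓ → Walk n u v ℓ → d u v ≤ ℓ)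

-- 1/k as a rational (the value at 0 is irrelevant: distinct vertices
-- are at distance ≥ 1)
recip : ℕ → ℚ
recip zero    = 0ℚ
recip (suc k) = + 1 /ℚ suc k

sumℚ : List ℚ → ℚ
sumℚ = foldr _+ℚ_ 0ℚ

rs : (n : ℕ) → (ℕ → ℕ → ℕ) → ℕ → ℚ
rs n d v = sumℚ (concatMap (λ u → if ⌊ u Data.Nat.≟ v ⌋ then [] else (recip (d u v) ∷ [])) (upTo (2 ^ n)))

-- Formal "polynomials" in x with rational exponents, as lists of
-- monomials (coefficient , exponent); two are equal iff every exponent
-- has the same total coefficient.

Poly : Set
Poly = List (ℕ × ℚ)

coeff : Poly → ℚ → ℕ
coeff []            e = 0
coeff ((c , f) ∷ p) e = (if ⌊ f ℚP.≟ e ⌋ then c else 0) + coeff p e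

_≈P_ : Poly → Poly → Set
p ≈P q = ∀ e → coeff p e ≡ coeff q e

Hrs : (n : ℕ) → (adj? : ∀ u v → Dec (Adj n u v)) → (ℕ → ℕ → ℕ) → Poly
Hrs n adj? d =
  concatMap (λ v →
    concatMap (λ u →
      if ⌊ u <? v ⌋ then (if ⌊ adj? u v ⌋ then ((1 , rs n d u +ℚ rs n d v) ∷ []) else [])
      else [])
    (upTo (2 ^ n)))
  (upTo (2 ^ n))

ℕ→ℚ : ℕ → ℚ
ℕ→ℚ k = + k /ℚ 1

HrsFormula : ℕ → Poly
HrsFormula n =
  (2 ^ (n ∸ 1) ∸ 1 , + (2 ^ (n + 2) ∸ 2 ^ (n ∸ 1) ∸ 4) /ℚ 2) ∷
  (2 ^ (n ∸ 1) , ℕ→ℚ (2 ^ n + 2 ^ (n ∸ 1) ∸ 1)) ∷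
  ((2 ^ (n ∸ 1) ∸ 1) C 2 , ℕ→ℚ (2 ^ n + 2 ^ (n ∸ 1) ∸ 2)) ∷ []

-- In G(n), P(n) is the cyclic group ℤ/m (m = 2^(n-1)), whose cyclic subgroups form a
-- chain, so P(n) induces a complete graph; every v ∈ H(n) satisfies v ⊕ v = 0 and
-- v ⊕ 0 = v, so its only neighbour is 0.  Hence 0 is adjacent to everything, all
-- distances are 1 or 2, and rs takes the three values 2m - 1 on 0, (3m - 2)/2 on
-- P(n) \ {0} and m on H(n).  Counting the m - 1 edges 0–P, the m edges 0–H and the
-- C(m-1, 2) edges inside P(n) \ {0} gives the polynomial.
module Submission where

open import Defs
open import Data.Nat using (ℕ; zero; suc; _+_; _*_; _∸_; _^_; _≤_; _<_; _<?_; _≟_; NonZero; z≤n; s≤s; z<s; s<s)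
open import Data.Nat.Properties
open import Data.Nat.DivMod using (_%_; _/_; m*n/n≡m; m*n%n≡0; m<n⇒m%n≡m; m%n<n; %-distribˡ-+; m%n%n≡m%n; [m+n]%n≡m%n; [m+kn]%n≡m%n)
open import Data.Nat.Divisibility using (_∣_; divides; _∣?_; ∣1⇒≡1; *-cancelʳ-∣; ∣-trans)
open import Data.Nat.Coprimality using (Coprime; coprime-divisor)
open import Data.Nat.Primality using (irreducible[2])
open import Data.Nat.GCD using (gcd; gcd-GCD; gcd[m,n]∣m; gcd[m,n]∣n; module Bézout)
open import Data.Nat.Combinatorics using (_C_; nC1≡n; nCk+nC[k+1]≡[n+1]C[k+1])
open import Data.Nat.Tactic.RingSolver using (solve-∀)
import Data.Integer as ℤ
import Data.Integer.Properties as ℤ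
import Data.Integer.Tactic.RingSolver as ℤ
open import Data.Rational using (ℚ; toℚᵘ) renaming (_+_ to _+ℚ_; _/_ to _/ℚ_)
import Data.Rational.Properties as ℚ
open import Data.Rational.Unnormalised as ℚᵘ using (mkℚᵘ; *≡*)
import Data.Rational.Unnormalised.Properties as ℚᵘ
open import Data.List using (List; []; _∷_; _++_; applyUpTo; concatMap)
open import Data.Bool using (true; false; if_then_else_)
open import Data.Product using (∃; _,_; proj₁; proj₂)
import Data.Product as Product
open import Data.Sum using (_⊎_; inj₁; inj₂)
open import Data.Empty using (⊥-elim)
open import Function using (_∘_)
open import Relation.Nullary using (Dec; ¬_; yes; no)
open import Relation.Nullary.Decidable using (⌊_⌋)
open import Relation.Binary.PropositionalEquality

½ : ℕ → ℚ
½ k = ℤ.+ k /ℚ 2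

½-+ : ∀ a b → ½ a +ℚ ½ b ≡ ½ (a + b)
½-+ a b = ℚ.toℚᵘ-injective (begin
  toℚᵘ (½ a +ℚ ½ b)                  ≈⟨ ℚ.toℚᵘ-homo-+ (½ a) (½ b) ⟩
  toℚᵘ (½ a) ℚᵘ.+ toℚᵘ (½ b)         ≈⟨ ℚᵘ.+-cong (ℚ.toℚᵘ-fromℚᵘ (halfᵘ a)) (ℚ.toℚᵘ-fromℚᵘ (halfᵘ b)) ⟩
  halfᵘ a ℚᵘ.+ halfᵘ b               ≈⟨ *≡* numerators ⟩
  halfᵘ (a + b)                      ≈⟨ ℚᵘ.≃-sym (ℚ.toℚᵘ-fromℚᵘ (halfᵘ (a + b))) ⟩
  toℚᵘ (½ (a + b))                   ∎)
  where
  open ℚᵘ.≃-Reasoning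
  halfᵘ : ℕ → ℚᵘ.ℚᵘ
  halfᵘ k = mkℚᵘ (ℤ.+ k) 1
  halves : ∀ x y → (x ℤ.* ℤ.+ 2 ℤ.+ y ℤ.* ℤ.+ 2) ℤ.* ℤ.+ 2 ≡ (x ℤ.+ y) ℤ.* ℤ.+ 4
  halves = ℤ.solve-∀
  numerators : (ℤ.+ a ℤ.* ℤ.+ 2 ℤ.+ ℤ.+ b ℤ.* ℤ.+ 2) ℤ.* ℤ.+ 2 ≡ ℤ.+ (a + b) ℤ.* ℤ.+ 4
  numerators = trans (halves (ℤ.+ a) (ℤ.+ b)) (cong (ℤ._* ℤ.+ 4) (sym (ℤ.pos-+ a b)))

½-double : ∀ x → ½ (x + x) ≡ ℕ→ℚ x
½-double x = ℚ.fromℚᵘ-cong {mkℚᵘ (ℤ.+ (x + x)) 1} {mkℚᵘ (ℤ.+ x) 0}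
  (*≡* (trans (sym (ℤ.pos-* (x + x) 1)) (trans (cong ℤ.+_ (double x)) (ℤ.pos-* x 2))))
  where
  double : ∀ x → (x + x) * 1 ≡ x * 2
  double = solve-∀

∑< : ℕ → (ℕ → ℕ) → ℕ
∑< zero    f = 0
∑< (suc k) f = f 0 + ∑< k (λ i → f (suc i))

syntax ∑< k (λ i → e) = ∑[ i < k ] e

∑<-cong : ∀ k {f g : ℕ → ℕ} → (∀ i → i < k → f i ≡ g i) → ∑< k f ≡ ∑< k g
∑<-cong zero    eq = refl
∑<-cong (suc k) eq = cong₂ _+_ (eq 0 z<s) (∑<-cong k (λ i i<k → eq (suc i) (s<s i<k)))

∑<-const : ∀ k {f : ℕ → ℕ} {c} → (∀ i → i < k → f i ≡ c) → ∑< k f ≡ k * c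
∑<-const zero    eq = refl
∑<-const (suc k) eq = cong₂ _+_ (eq 0 z<s) (∑<-const k (λ i i<k → eq (suc i) (s<s i<k)))

∑<-+ : ∀ a b f → ∑< (a + b) f ≡ ∑< a f + ∑[ i < b ] f (a + i)
∑<-+ zero    b f = refl
∑<-+ (suc a) b f = trans (cong (f 0 +_) (∑<-+ a b _)) (sym (+-assoc (f 0) _ _))

∑<-suc : ∀ k f → ∑< (suc k) f ≡ ∑< k f + f k
∑<-suc zero    f = +-comm (f 0) 0
∑<-suc (suc k) f = trans (cong (f 0 +_) (∑<-suc k (λ i → f (suc i)))) (sym (+-assoc (f 0) _ _))

∑<-truncate : ∀ {k j} f → j ≤ k → (∀ i → j ≤ i → i < k → f i ≡ 0) → ∑< k f ≡ ∑< j f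
∑<-truncate {k} {zero} f _ vanish = trans (∑<-const k (λ i → vanish i z≤n)) (*-zeroʳ k)
∑<-truncate {suc k} {suc j} f (s≤s j≤k) vanish =
  cong (f 0 +_) (∑<-truncate _ j≤k (λ i j≤i i<k → vanish (suc i) (s≤s j≤i) (s<s i<k)))

∑<-except : ∀ {k f c} j → j < k → (∀ i → i < k → i ≢ j → f i ≡ c) → ∑< k f + c ≡ k * c + f j
∑<-except {suc k} {f} {c} zero _ eq = begin
  f 0 + ∑< k (λ i → f (suc i)) + c ≡⟨ cong (λ s → f 0 + s + c) (∑<-const k (λ i i<k → eq (suc i) (s<s i<k) λ ())) ⟩
  f 0 + k * c + c                   ≡⟨ rearrange (f 0) k c ⟩
  suc k * c + f 0                   ∎
  where
  open ≡-Reasoning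
  rearrange : ∀ a k c → a + k * c + c ≡ (c + k * c) + a
  rearrange = solve-∀
∑<-except {suc k} {f} {c} (suc j) (s<s j<k) eq = begin
  f 0 + ∑< k (λ i → f (suc i)) + c   ≡⟨ +-assoc (f 0) _ c ⟩
  f 0 + (∑< k (λ i → f (suc i)) + c) ≡⟨ cong₂ _+_ (eq 0 z<s λ ())
                                         (∑<-except j j<k λ i i<k i≢j → eq (suc i) (s<s i<k) (i≢j ∘ suc-injective)) ⟩
  c + (k * c + f (suc j))            ≡⟨ sym (+-assoc c _ _) ⟩
  suc k * c + f (suc j)              ∎
  where open ≡-Reasoning

∑<-arithmetic : ∀ k a b → ∑[ i < k ] (a + i * b) ≡ k * a + (k C 2) * b
∑<-arithmetic zero    a b = refl
∑<-arithmetic (suc k) a b = begin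
  ∑[ i < suc k ] (a + i * b)         ≡⟨ ∑<-suc k _ ⟩
  ∑[ i < k ] (a + i * b) + (a + k * b) ≡⟨ cong (_+ (a + k * b)) (∑<-arithmetic k a b) ⟩
  k * a + (k C 2) * b + (a + k * b)  ≡⟨ rearrange k a b (k C 2) ⟩
  suc k * a + (k + k C 2) * b        ≡⟨ cong (λ x → suc k * a + (x + k C 2) * b) (sym (nC1≡n k)) ⟩
  suc k * a + (k C 1 + k C 2) * b    ≡⟨ cong (λ x → suc k * a + x * b) (nCk+nC[k+1]≡[n+1]C[k+1] k 1) ⟩
  suc k * a + (suc k C 2) * b        ∎
  where
  open ≡-Reasoning
  rearrange : ∀ k a b c → k * a + c * b + (a + k * b) ≡ suc k * a + (k + c) * b
  rearrange = solve-∀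

∣2^⇒≡2^ : ∀ a {d} → d ∣ 2 ^ a → ∃ λ i → d ≡ 2 ^ i
∣2^⇒≡2^ zero    d∣1 = 0 , ∣1⇒≡1 d∣1
∣2^⇒≡2^ (suc a) {d} d∣2^[1+a] with 2 ∣? d
... | yes (divides e refl) =
  Product.map suc (λ e≡2^i → trans (*-comm e 2) (cong (2 *_) e≡2^i))
    (∣2^⇒≡2^ a (*-cancelʳ-∣ {e} 2 (subst (e * 2 ∣_) (*-comm 2 (2 ^ a)) d∣2^[1+a])))
... | no 2∤d = ∣2^⇒≡2^ a (coprime-divisor odd d∣2^[1+a])
  where
  odd : Coprime d 2
  odd (i∣d , i∣2) with irreducible[2] i∣2
  ... | inj₁ i≡1 = i≡1
  ... | inj₂ refl = ⊥-elim (2∤d i∣d)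

2^∣2^ : ∀ {i j} → i ≤ j → 2 ^ i ∣ 2 ^ j
2^∣2^ {i} {j} i≤j = divides (2 ^ (j ∸ i))
  (trans (cong (2 ^_) (sym (m∸n+n≡m i≤j))) (^-distribˡ-+-* 2 (j ∸ i) i))

∣2^-total : ∀ a {d e} → d ∣ 2 ^ a → e ∣ 2 ^ a → d ∣ e ⊎ e ∣ d
∣2^-total a d∣ e∣ with ∣2^⇒≡2^ a d∣ | ∣2^⇒≡2^ a e∣
... | i , refl | j , refl with ≤-total i j
...   | inj₁ i≤j = inj₁ (2^∣2^ i≤j)
...   | inj₂ j≤i = inj₂ (2^∣2^ j≤i)

gcd∣⇒≡multiple : ∀ u v M .{{_ : NonZero M}} → gcd u M ∣ v → ∃ λ k → (suc k * u) % M ≡ v % M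
gcd∣⇒≡multiple u v M@(suc M-1) (divides w refl) = positive (multiplier (Bézout.identity (gcd-GCD u M)))
  where
  open ≡-Reasoning
  g = gcd u M
  multiplier : Bézout.Identity g u M → ∃ λ a → (a * u) % M ≡ (w * g) % M
  multiplier (Bézout.+- x y g+yM≡xu) = w * x , (begin
    (w * x * u) % M          ≡⟨ cong (_% M) (*-assoc w x u) ⟩
    (w * (x * u)) % M        ≡⟨ cong (λ t → (w * t) % M) (sym g+yM≡xu) ⟩
    (w * (g + y * M)) % M    ≡⟨ cong (_% M) (expand w g y M) ⟩
    (w * g + w * y * M) % M  ≡⟨ [m+kn]%n≡m%n (w * g) (w * y) M ⟩
    (w * g) % M              ∎)
    where
    expand : ∀ w g y M → w * (g + y * M) ≡ w * g + w * y * M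
    expand = solve-∀
  multiplier (Bézout.-+ x y g+xu≡yM) = a , (begin
    (a * u) % M                    ≡⟨ sym ([m+kn]%n≡m%n (a * u) (w * y) M) ⟩
    (a * u + w * y * M) % M        ≡⟨ cong (λ t → (a * u + t) % M) (*-assoc w y M) ⟩
    (a * u + w * (y * M)) % M      ≡⟨ cong (λ t → (a * u + w * t) % M) (sym g+xu≡yM) ⟩
    (a * u + w * (g + x * u)) % M  ≡⟨ cong (_% M) (collect w x M-1 u g) ⟩
    (w * g + w * x * u * M) % M    ≡⟨ [m+kn]%n≡m%n (w * g) (w * x * u) M ⟩
    (w * g) % M                    ∎)
    where
    a = w * x * M-1
    collect : ∀ w x m u g → w * x * m * u + w * (g + x * u) ≡ w * g + w * x * u * suc m
    collect = solve-∀
  positive : (∃ λ a → (a * u) % M ≡ (w * g) % M) → ∃ λ k → (suc k * u) % M ≡ (w * g) % M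
  positive (a , a*u≡) = a + M-1 , trans (cong (_% M) (wrap a M-1 u)) (trans ([m+kn]%n≡m%n (a * u) u M) a*u≡)
    where
    wrap : ∀ a m u → suc (a + m) * u ≡ a * u + u * suc m
    wrap = solve-∀

[m+n%d]%d≡[m+n]%d : ∀ m n d .{{_ : NonZero d}} → (m + n % d) % d ≡ (m + n) % d
[m+n%d]%d≡[m+n]%d m n d = begin
  (m + n % d) % d           ≡⟨ %-distribˡ-+ m (n % d) d ⟩
  (m % d + n % d % d) % d   ≡⟨ cong (λ x → (m % d + x) % d) (m%n%n≡m%n n d) ⟩
  (m % d + n % d) % d       ≡⟨ sym (%-distribˡ-+ m n d) ⟩
  (m + n) % d               ∎
  where open ≡-Reasoning

n%d+d≡n : ∀ {n d} .{{_ : NonZero d}} → d ≤ n → n < d + d → n % d + d ≡ n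
n%d+d≡n {n} {d} d≤n n<2d = begin
  n % d + d             ≡⟨ cong (λ x → x % d + d) (sym (m∸n+n≡m d≤n)) ⟩
  (n ∸ d + d) % d + d   ≡⟨ cong (_+ d) ([m+n]%n≡m%n (n ∸ d) d) ⟩
  (n ∸ d) % d + d       ≡⟨ cong (_+ d) (m<n⇒m%n≡m (subst (n ∸ d <_) (m+n∸m≡n d d) (∸-monoˡ-< n<2d d≤n))) ⟩
  n ∸ d + d             ≡⟨ m∸n+n≡m d≤n ⟩
  n                     ∎
  where open ≡-Reasoning

-- Power graphs with a dominating vertex

Adj-sym : ∀ {n u v} → Adj n u v → Adj n v u
Adj-sym (u∈ , v∈ , u≢v , inj₁ v=uᵏ) = v∈ , u∈ , u≢v ∘ sym , inj₂ v=uᵏ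
Adj-sym (u∈ , v∈ , u≢v , inj₂ u=vᵏ) = v∈ , u∈ , u≢v ∘ sym , inj₁ u=vᵏ

module _ {n} {d : ℕ → ℕ → ℕ} (isD : IsDistance n d) where

  Adj⇒distance≡1 : ∀ {u v} → Adj n u v → d u v ≡ 1
  Adj⇒distance≡1 {u} {v} adj@(u∈ , v∈ , u≢v , _) =
    shortest u≢v (proj₁ (isD u v u∈ v∈)) (proj₂ (isD u v u∈ v∈) 1 (step adj (here v∈)))
    where
    shortest : ∀ {u v k} → u ≢ v → Walk n u v k → k ≤ 1 → k ≡ 1
    shortest u≢v (here _)             _ = ⊥-elim (u≢v refl)
    shortest _   (step _ (here _))    _ = refl
    shortest _   (step _ (step _ _)) (s≤s ())

  module _ {c} (dominating : ∀ {x} → Vertex n x → x ≢ c → Adj n c x) where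

    ¬Adj⇒distance≡2 : ∀ {u v} → Vertex n u → Vertex n v → u ≢ v → ¬ Adj n u v → d u v ≡ 2
    ¬Adj⇒distance≡2 {u} {v} u∈ v∈ u≢v ¬adj =
      shortest u≢v ¬adj (proj₁ (isD u v u∈ v∈))
        (proj₂ (isD u v u∈ v∈) 2 (step (Adj-sym (dominating u∈ u≢c)) (step (dominating v∈ v≢c) (here v∈))))
      where
      u≢c : u ≢ c
      u≢c refl = ¬adj (dominating v∈ (λ v≡u → u≢v (sym v≡u)))
      v≢c : v ≢ c
      v≢c refl = ¬adj (Adj-sym (dominating u∈ u≢v))
      shortest : ∀ {u v k} → u ≢ v → ¬ Adj n u v → Walk n u v k → k ≤ 2 → k ≡ 2
      shortest u≢v _    (here _)                      _ = ⊥-elim (u≢v refl)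
      shortest _   ¬adj (step adj (here _))           _ = ⊥-elim (¬adj adj)
      shortest _   _    (step _ (step _ (here _)))    _ = refl
      shortest _   _    (step _ (step _ (step _ _))) (s≤s (s≤s ()))

sumℚ-++ : ∀ (p q : List ℚ) → sumℚ (p ++ q) ≡ sumℚ p +ℚ sumℚ q
sumℚ-++ []      q = sym (ℚ.+-identityˡ (sumℚ q))
sumℚ-++ (x ∷ p) q = trans (cong (x +ℚ_) (sumℚ-++ p q)) (sym (ℚ.+-assoc x (sumℚ p) (sumℚ q)))

sumℚ-concatMap-½ : ∀ (F : ℕ → List ℚ) k g (w : ℕ → ℕ) → (∀ i → i < k → sumℚ (F (g i)) ≡ ½ (w i)) →
                   sumℚ (concatMap F (applyUpTo g k)) ≡ ½ (∑< k w)
sumℚ-concatMap-½ F zero    g w eq = refl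
sumℚ-concatMap-½ F (suc k) g w eq = begin
  sumℚ (F (g 0) ++ concatMap F (applyUpTo (λ i → g (suc i)) k))  ≡⟨ sumℚ-++ (F (g 0)) _ ⟩
  sumℚ (F (g 0)) +ℚ sumℚ (concatMap F (applyUpTo (λ i → g (suc i)) k))
    ≡⟨ cong₂ _+ℚ_ (eq 0 z<s) (sumℚ-concatMap-½ F k _ _ (λ i i<k → eq (suc i) (s<s i<k))) ⟩
  ½ (w 0) +ℚ ½ (∑< k (λ i → w (suc i)))                          ≡⟨ ½-+ (w 0) _ ⟩
  ½ (∑< (suc k) w)                                                ∎
  where open ≡-Reasoning

module _ {n} (adj? : ∀ u v → Dec (Adj n u v)) where

  -- twice the reciprocal distance, once all distances are known to be 1 or 2
  weight : ℕ → ℕ → ℕ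
  weight v u = if ⌊ u ≟ v ⌋ then 0 else if ⌊ adj? u v ⌋ then 2 else 1

  weight-self : ∀ v → weight v v ≡ 0
  weight-self v with v ≟ v
  ... | yes _   = refl
  ... | no v≢v = ⊥-elim (v≢v refl)

  weight-Adj : ∀ {u v} → Adj n u v → weight v u ≡ 2
  weight-Adj {u} {v} adj@(_ , _ , u≢v , _) with u ≟ v | adj? u v
  ... | yes u≡v | _       = ⊥-elim (u≢v u≡v)
  ... | no _    | yes _   = refl
  ... | no _    | no ¬adj = ⊥-elim (¬adj adj)

  weight-¬Adj : ∀ {u v} → u ≢ v → ¬ Adj n u v → weight v u ≡ 1
  weight-¬Adj {u} {v} u≢v ¬adj with u ≟ v | adj? u v
  ... | yes u≡v | _       = ⊥-elim (u≢v u≡v)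
  ... | no _    | yes adj = ⊥-elim (¬adj adj)
  ... | no _    | no _    = refl

  module _ {d : ℕ → ℕ → ℕ} (isD : IsDistance n d) {c} (dominating : ∀ {x} → Vertex n x → x ≢ c → Adj n c x) where

    rs≡½∑weight : ∀ {v} → Vertex n v → rs n d v ≡ ½ (∑[ u < 2 ^ n ] weight v u)
    rs≡½∑weight {v} v∈ = sumℚ-concatMap-½ _ (2 ^ n) (λ i → i) (weight v) term
      where
      term : ∀ u → u < 2 ^ n → sumℚ (if ⌊ u ≟ v ⌋ then [] else recip (d u v) ∷ []) ≡ ½ (weight v u)
      term u u∈ with u ≟ v
      ... | yes _ = refl
      ... | no u≢v with adj? u v
      ...   | yes adj rewrite Adj⇒distance≡1 isD adj = refl
      ...   | no ¬adj rewrite ¬Adj⇒distance≡2 isD dominating u∈ v∈ u≢v ¬adj = refl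

x^ : ℚ → Poly
x^ q = (1 , q) ∷ []

coeff-∷ : ∀ c f p e → coeff ((c , f) ∷ p) e ≡ c * coeff (x^ f) e + coeff p e
coeff-∷ c f p e = cong (_+ coeff p e) (scale ⌊ f ℚ.≟ e ⌋)
  where
  scale : ∀ b → (if b then c else 0) ≡ c * ((if b then 1 else 0) + 0)
  scale true  = sym (*-identityʳ c)
  scale false = sym (*-zeroʳ c)

coeff-++ : ∀ p q e → coeff (p ++ q) e ≡ coeff p e + coeff q e
coeff-++ []            q e = refl
coeff-++ ((c , f) ∷ p) q e = trans (cong (_ +_) (coeff-++ p q e)) (sym (+-assoc _ (coeff p e) (coeff q e)))

coeff-concatMap : ∀ (G : ℕ → Poly) k g e → coeff (concatMap G (applyUpTo g k)) e ≡ ∑[ i < k ] coeff (G (g i)) e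
coeff-concatMap G zero    g e = refl
coeff-concatMap G (suc k) g e =
  trans (coeff-++ (G (g 0)) _ e) (cong (coeff (G (g 0)) e +_) (coeff-concatMap G k (λ i → g (suc i)) e))

module _ {n} (adj? : ∀ u v → Dec (Adj n u v)) (d : ℕ → ℕ → ℕ) where

  edgeTerm : ℕ → ℕ → Poly
  edgeTerm u v = if ⌊ u <? v ⌋ then (if ⌊ adj? u v ⌋ then x^ (rs n d u +ℚ rs n d v) else []) else []

  coeff-Hrs : ∀ e → coeff (Hrs n adj? d) e ≡ ∑[ v < 2 ^ n ] ∑[ u < 2 ^ n ] coeff (edgeTerm u v) e
  coeff-Hrs e = trans (coeff-concatMap _ (2 ^ n) (λ v → v) e)
                      (∑<-cong (2 ^ n) (λ v _ → coeff-concatMap (λ u → edgeTerm u v) (2 ^ n) (λ u → u) e))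

  edgeTerm-≥ : ∀ {u v} → ¬ u < v → edgeTerm u v ≡ []
  edgeTerm-≥ {u} {v} u≮v with u <? v
  ... | yes u<v = ⊥-elim (u≮v u<v)
  ... | no _    = refl

  edgeTerm-¬Adj : ∀ {u v} → ¬ Adj n u v → edgeTerm u v ≡ []
  edgeTerm-¬Adj {u} {v} ¬adj with u <? v | adj? u v
  ... | no _  | _       = refl
  ... | yes _ | no _    = refl
  ... | yes _ | yes adj = ⊥-elim (¬adj adj)

  edgeTerm-Adj : ∀ {u v} → u < v → Adj n u v → edgeTerm u v ≡ x^ (rs n d u +ℚ rs n d v)
  edgeTerm-Adj {u} {v} u<v adj with u <? v | adj? u v
  ... | no u≮v | _       = ⊥-elim (u≮v u<v)
  ... | yes _  | no ¬adj = ⊥-elim (¬adj adj)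
  ... | yes _  | yes _   = refl

-- The gyrogroup G(n)

-- n = r + 2: the count below needs only n ≥ 2
module Gyrogroup (r : ℕ) where

  n : ℕ
  n = suc (suc r)

  m : ℕ
  m = half n

  instance
    m-nonZero : NonZero m
    m-nonZero = half-nonZero n

  m-1 : ℕ
  m-1 = m ∸ 1

  0<m : 0 < m
  0<m = m^n>0 2 (suc r)

  1+[m-1]≡m : suc m-1 ≡ m
  1+[m-1]≡m = trans (+-comm 1 m-1) (m∸n+n≡m 0<m)

  2ⁿ≡m+m : 2 ^ n ≡ m + m
  2ⁿ≡m+m = cong (m +_) (+-identityʳ m)

  ⊕-PP : ∀ {a b} → a < m → b < m → gyro n a b ≡ (a + b) % m
  ⊕-PP {a} {b} a<m b<m with a <? m | b <? m
  ... | yes _ | yes _   = refl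
  ... | no a≮m | _      = ⊥-elim (a≮m a<m)
  ... | yes _ | no b≮m  = ⊥-elim (b≮m b<m)

  m/2+1+m/2∸1≡m : (m / 2 + 1) + (m / 2 ∸ 1) ≡ m
  m/2+1+m/2∸1≡m = begin
    (m / 2 + 1) + (m / 2 ∸ 1)   ≡⟨ cong (λ k → (k + 1) + (k ∸ 1)) m/2≡2^r ⟩
    (2 ^ r + 1) + (2 ^ r ∸ 1)   ≡⟨ +-assoc (2 ^ r) 1 (2 ^ r ∸ 1) ⟩
    2 ^ r + (1 + (2 ^ r ∸ 1))   ≡⟨ cong (2 ^ r +_) (m+[n∸m]≡n (m^n>0 2 r)) ⟩
    2 ^ r + 2 ^ r               ≡⟨ cong (2 ^ r +_) (sym (+-identityʳ (2 ^ r))) ⟩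
    m                           ∎
    where
    open ≡-Reasoning
    m/2≡2^r : m / 2 ≡ 2 ^ r
    m/2≡2^r = trans (cong (_/ 2) (*-comm 2 (2 ^ r))) (m*n/n≡m (2 ^ r) 2)

  ⊕-HH-self : ∀ {v} → m ≤ v → gyro n v v ≡ 0
  ⊕-HH-self {v} m≤v with v <? m
  ... | yes v<m = ⊥-elim (<⇒≱ v<m m≤v)
  ... | no _    = begin
    ((m / 2 + 1) * v + (m / 2 ∸ 1) * v) % m   ≡⟨ cong (_% m) (sym (*-distribʳ-+ v (m / 2 + 1) (m / 2 ∸ 1))) ⟩
    ((m / 2 + 1 + (m / 2 ∸ 1)) * v) % m       ≡⟨ cong (λ k → (k * v) % m) m/2+1+m/2∸1≡m ⟩
    (m * v) % m                               ≡⟨ cong (_% m) (*-comm m v) ⟩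
    (v * m) % m                               ≡⟨ m*n%n≡0 v m ⟩
    0                                         ∎
    where open ≡-Reasoning

  ⊕-H0 : ∀ {v} → m ≤ v → v < m + m → gyro n v 0 ≡ v
  ⊕-H0 {v} m≤v v<2m with v <? m | 0 <? m
  ... | yes v<m | _     = ⊥-elim (<⇒≱ v<m m≤v)
  ... | no _    | no 0≮m = ⊥-elim (0≮m 0<m)
  ... | no _    | yes _ = begin
    (v + (m / 2 ∸ 1) * 0) % m + m   ≡⟨ cong (λ x → (v + x) % m + m) (*-zeroʳ (m / 2 ∸ 1)) ⟩
    (v + 0) % m + m                 ≡⟨ cong (λ x → x % m + m) (+-identityʳ v) ⟩
    v % m + m                       ≡⟨ n%d+d≡n m≤v v<2m ⟩
    v                               ∎
    where open ≡-Reasoning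

  powS-P : ∀ {a} k → a < m → powS n a k ≡ (suc k * a) % m
  powS-P {a} zero    a<m = sym (trans (cong (_% m) (+-identityʳ a)) (m<n⇒m%n≡m a<m))
  powS-P {a} (suc k) a<m = begin
    gyro n a (powS n a k)        ≡⟨ cong (gyro n a) (powS-P k a<m) ⟩
    gyro n a ((suc k * a) % m)   ≡⟨ ⊕-PP a<m (m%n<n _ m) ⟩
    (a + (suc k * a) % m) % m    ≡⟨ [m+n%d]%d≡[m+n]%d a (suc k * a) m ⟩
    (suc (suc k) * a) % m        ∎
    where open ≡-Reasoning

  powS-H : ∀ {v} k → m ≤ v → v < m + m → powS n v k ≡ v ⊎ powS n v k ≡ 0
  powS-H zero    _   _    = inj₁ refl
  powS-H {v} (suc k) m≤v v<2m with powS-H k m≤v v<2m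
  ... | inj₁ vᵏ≡v = inj₂ (trans (cong (gyro n v) vᵏ≡v) (⊕-HH-self m≤v))
  ... | inj₂ vᵏ≡0 = inj₁ (trans (cong (gyro n v) vᵏ≡0) (⊕-H0 m≤v v<2m))

  Vertex-m+m : ∀ {u} → u < m + m → Vertex n u
  Vertex-m+m {u} = subst (u <_) (sym 2ⁿ≡m+m)

  Adj-PP : ∀ {u v} → u < m → v < m → u ≢ v → Adj n u v
  Adj-PP {u} {v} u<m v<m u≢v = Vertex-m+m (m≤n⇒m≤n+o m u<m) , Vertex-m+m (m≤n⇒m≤n+o m v<m) , u≢v , powers
    where
    power : ∀ {a b} → a < m → b < m → gcd a m ∣ b → ∃ λ k → powS n a k ≡ b
    power {a} {b} a<m b<m g∣b with gcd∣⇒≡multiple a b m g∣b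
    ... | k , eq = k , trans (powS-P k a<m) (trans eq (m<n⇒m%n≡m b<m))
    -- the cyclic subgroups of ℤ/2^(n-1) form a chain
    powers : (∃ λ k → powS n u k ≡ v) ⊎ (∃ λ k → powS n v k ≡ u)
    powers with ∣2^-total (suc r) (gcd[m,n]∣n u m) (gcd[m,n]∣n v m)
    ... | inj₁ gu∣gv = inj₁ (power u<m v<m (∣-trans gu∣gv (gcd[m,n]∣m v m)))
    ... | inj₂ gv∣gu = inj₂ (power v<m u<m (∣-trans gv∣gu (gcd[m,n]∣m u m)))

  Adj-0H : ∀ {v} → m ≤ v → v < m + m → Adj n 0 v
  Adj-0H m≤v v<2m =
    Vertex-m+m (m≤n⇒m≤n+o m 0<m) , Vertex-m+m v<2m , (λ 0≡v → <⇒≱ 0<m (subst (m ≤_) (sym 0≡v) m≤v)) ,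
    inj₂ (1 , ⊕-HH-self m≤v)

  ¬Adj-PH : ∀ {u v} → 0 < u → u < m → m ≤ v → v < m + m → ¬ Adj n u v
  ¬Adj-PH {u} 0<u u<m m≤v v<2m (_ , _ , _ , inj₁ (k , uᵏ≡v)) =
    <⇒≱ (subst (_< m) (trans (sym (powS-P k u<m)) uᵏ≡v) (m%n<n _ m)) m≤v
  ¬Adj-PH {u} {v} 0<u u<m m≤v v<2m (_ , _ , _ , inj₂ (k , vᵏ≡u)) with powS-H k m≤v v<2m
  ... | inj₁ vᵏ≡v = <⇒≱ u<m (subst (m ≤_) (trans (sym vᵏ≡v) vᵏ≡u) m≤v)
  ... | inj₂ vᵏ≡0 = <⇒≢ 0<u (trans (sym vᵏ≡0) vᵏ≡u)

  ¬Adj-HH : ∀ {u v} → m ≤ u → u < m + m → m ≤ v → v < m + m → ¬ Adj n u v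
  ¬Adj-HH {u} {v} m≤u u<2m m≤v v<2m (_ , _ , u≢v , inj₁ (k , uᵏ≡v)) with powS-H k m≤u u<2m
  ... | inj₁ uᵏ≡u = u≢v (trans (sym uᵏ≡u) uᵏ≡v)
  ... | inj₂ uᵏ≡0 = <⇒≱ 0<m (subst (m ≤_) (trans (sym uᵏ≡v) uᵏ≡0) m≤v)
  ¬Adj-HH {u} {v} m≤u u<2m m≤v v<2m (_ , _ , u≢v , inj₂ (k , vᵏ≡u)) with powS-H k m≤v v<2m
  ... | inj₁ vᵏ≡v = u≢v (trans (sym vᵏ≡u) vᵏ≡v)
  ... | inj₂ vᵏ≡0 = <⇒≱ 0<m (subst (m ≤_) (trans (sym vᵏ≡u) vᵏ≡0) m≤u)

  Adj-0 : ∀ {x} → Vertex n x → x ≢ 0 → Adj n 0 x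
  Adj-0 {x} x∈ x≢0 with x <? m
  ... | yes x<m = Adj-PP 0<m x<m (x≢0 ∘ sym)
  ... | no x≮m  = Adj-0H (≮⇒≥ x≮m) (subst (x <_) 2ⁿ≡m+m x∈)

  -- twice the reciprocal statuses of 0, of P(n) \ {0} and of H(n), with m = 1 + m-1
  ρ₀ ρP ρH : ℕ
  ρ₀ = 2 + 4 * m-1
  ρP = 1 + 3 * m-1
  ρH = 2 + 2 * m-1

  edgePolynomial : Poly
  edgePolynomial = (m-1 , ½ ρ₀ +ℚ ½ ρP) ∷ (m , ½ ρ₀ +ℚ ½ ρH) ∷ (m-1 C 2 , ½ ρP +ℚ ½ ρP) ∷ []

  2^[n+2]≡8m : 2 ^ (n + 2) ≡ 2 * (2 * (2 * m))
  2^[n+2]≡8m = cong (λ k → 2 * (2 * 2 ^ k)) (+-comm r 2)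

  ρ₀+ρP≡2^[n+2]∸m∸4 : ρ₀ + ρP ≡ 2 ^ (n + 2) ∸ m ∸ 4
  ρ₀+ρP≡2^[n+2]∸m∸4 = sym (begin
    2 ^ (n + 2) ∸ m ∸ 4                        ≡⟨ cong (λ k → k ∸ m ∸ 4) 2^[n+2]≡8m ⟩
    2 * (2 * (2 * m)) ∸ m ∸ 4                  ≡⟨ cong (λ k → 2 * (2 * (2 * k)) ∸ k ∸ 4) (sym 1+[m-1]≡m) ⟩
    2 * (2 * (2 * suc m-1)) ∸ suc m-1 ∸ 4      ≡⟨ cong (λ k → k ∸ suc m-1 ∸ 4) (arith m-1) ⟩
    suc m-1 + (4 + (ρ₀ + ρP)) ∸ suc m-1 ∸ 4    ≡⟨ cong (_∸ 4) (m+n∸m≡n (suc m-1) _) ⟩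
    4 + (ρ₀ + ρP) ∸ 4                          ≡⟨ m+n∸m≡n 4 _ ⟩
    ρ₀ + ρP                                    ∎)
    where
    open ≡-Reasoning
    arith : ∀ k → 2 * (2 * (2 * suc k)) ≡ suc k + (4 + ((2 + 4 * k) + (1 + 3 * k)))
    arith = solve-∀

  ρ₀+ρH≡2[2ⁿ+m∸1] : ρ₀ + ρH ≡ (2 ^ n + m ∸ 1) + (2 ^ n + m ∸ 1)
  ρ₀+ρH≡2[2ⁿ+m∸1] = begin
    ρ₀ + ρH                                    ≡⟨ arith m-1 ⟩
    (2 + 3 * m-1) + (2 + 3 * m-1)              ≡⟨ cong (λ k → k + k) (sym (m+n∸m≡n 1 (2 + 3 * m-1))) ⟩
    (1 + (2 + 3 * m-1) ∸ 1) + (1 + (2 + 3 * m-1) ∸ 1)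
      ≡⟨ cong (λ k → (k ∸ 1) + (k ∸ 1)) (trans (sym (arith′ m-1)) (cong (λ k → 2 * k + k) 1+[m-1]≡m)) ⟩
    (2 ^ n + m ∸ 1) + (2 ^ n + m ∸ 1)          ∎
    where
    open ≡-Reasoning
    arith : ∀ k → (2 + 4 * k) + (2 + 2 * k) ≡ (2 + 3 * k) + (2 + 3 * k)
    arith = solve-∀
    arith′ : ∀ k → 2 * suc k + suc k ≡ 1 + (2 + 3 * k)
    arith′ = solve-∀

  ρP+ρP≡2[2ⁿ+m∸2] : ρP + ρP ≡ (2 ^ n + m ∸ 2) + (2 ^ n + m ∸ 2)
  ρP+ρP≡2[2ⁿ+m∸2] = begin
    ρP + ρP                                    ≡⟨ cong (λ k → k + k) (sym (m+n∸m≡n 2 ρP)) ⟩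
    (2 + ρP ∸ 2) + (2 + ρP ∸ 2)
      ≡⟨ cong (λ k → (k ∸ 2) + (k ∸ 2)) (trans (sym (arith m-1)) (cong (λ k → 2 * k + k) 1+[m-1]≡m)) ⟩
    (2 ^ n + m ∸ 2) + (2 ^ n + m ∸ 2)          ∎
    where
    open ≡-Reasoning
    arith : ∀ k → 2 * suc k + suc k ≡ 2 + (1 + 3 * k)
    arith = solve-∀

  HrsFormula≡edgePolynomial : HrsFormula n ≡ edgePolynomial
  HrsFormula≡edgePolynomial =
    cong₂ _∷_ (cong (m-1 ,_) (trans (cong ½ (sym ρ₀+ρP≡2^[n+2]∸m∸4)) (sym (½-+ ρ₀ ρP))))
    (cong₂ _∷_ (cong (m ,_) (ℕ→ℚ≡½+½ ρ₀ ρH (2 ^ n + m ∸ 1) ρ₀+ρH≡2[2ⁿ+m∸1]))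
    (cong (λ q → (m-1 C 2 , q) ∷ []) (ℕ→ℚ≡½+½ ρP ρP (2 ^ n + m ∸ 2) ρP+ρP≡2[2ⁿ+m∸2])))
    where
    ℕ→ℚ≡½+½ : ∀ x y z → x + y ≡ z + z → ℕ→ℚ z ≡ ½ x +ℚ ½ y
    ℕ→ℚ≡½+½ x y z x+y≡2z = sym (trans (½-+ x y) (trans (cong ½ x+y≡2z) (½-double z)))

  module Status (adj? : ∀ u v → Dec (Adj n u v)) {d : ℕ → ℕ → ℕ} (isD : IsDistance n d) where

    w : ℕ → ℕ → ℕ
    w = weight adj?

    ∑w-0 : ∑[ u < m + m ] w 0 u ≡ ρ₀
    ∑w-0 = +-cancelʳ-≡ 2 _ _ (begin
      ∑[ u < m + m ] w 0 u + 2   ≡⟨ ∑<-except 0 (m≤n⇒m≤n+o m 0<m) (λ i i<2m i≢0 → weight-Adj adj? (Adj-sym (Adj-0 (Vertex-m+m i<2m) i≢0))) ⟩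
      (m + m) * 2 + w 0 0        ≡⟨ cong ((m + m) * 2 +_) (weight-self adj? 0) ⟩
      (m + m) * 2 + 0            ≡⟨ cong (λ k → (k + k) * 2 + 0) (sym 1+[m-1]≡m) ⟩
      (suc m-1 + suc m-1) * 2 + 0 ≡⟨ arith m-1 ⟩
      ρ₀ + 2                     ∎)
      where
      open ≡-Reasoning
      arith : ∀ k → (suc k + suc k) * 2 + 0 ≡ (2 + 4 * k) + 2
      arith = solve-∀

    ∑w-P : ∀ {v} → 0 < v → v < m → ∑[ u < m + m ] w v u ≡ ρP
    ∑w-P {v} 0<v v<m = +-cancelʳ-≡ 2 _ _ (begin
      ∑[ u < m + m ] w v u + 2        ≡⟨ cong (_+ 2) (∑<-+ m m (w v)) ⟩
      ∑P + ∑H + 2                     ≡⟨ arith₁ ∑P ∑H ⟩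
      (∑P + 2) + ∑H                   ≡⟨ cong₂ _+_ ∑P+2 ∑H≡ ⟩
      (m * 2 + 0) + m * 1             ≡⟨ cong (λ k → (k * 2 + 0) + k * 1) (sym 1+[m-1]≡m) ⟩
      (suc m-1 * 2 + 0) + suc m-1 * 1 ≡⟨ arith₂ m-1 ⟩
      ρP + 2                          ∎)
      where
      open ≡-Reasoning
      ∑P = ∑[ u < m ] w v u
      ∑H = ∑[ i < m ] w v (m + i)
      ∑P+2 : ∑P + 2 ≡ m * 2 + 0
      ∑P+2 = trans (∑<-except v v<m (λ i i<m i≢v → weight-Adj adj? (Adj-PP i<m v<m i≢v)))
                   (cong (m * 2 +_) (weight-self adj? v))
      ∑H≡ : ∑H ≡ m * 1
      ∑H≡ = ∑<-const m (λ i i<m → weight-¬Adj adj?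
              (λ m+i≡v → <⇒≱ v<m (subst (m ≤_) m+i≡v (m≤m+n m i)))
              (λ adj → ¬Adj-PH 0<v v<m (m≤m+n m i) (+-monoʳ-< m i<m) (Adj-sym adj)))
      arith₁ : ∀ a b → a + b + 2 ≡ (a + 2) + b
      arith₁ = solve-∀
      arith₂ : ∀ k → (suc k * 2 + 0) + suc k * 1 ≡ (1 + 3 * k) + 2
      arith₂ = solve-∀

    ∑w-H : ∀ {v} → m ≤ v → v < m + m → ∑[ u < m + m ] w v u ≡ ρH
    ∑w-H {v} m≤v v<2m = +-cancelʳ-≡ 2 _ _ (begin
      ∑[ u < m + m ] w v u + 2            ≡⟨ cong (_+ 2) (∑<-+ m m (w v)) ⟩
      ∑P + ∑H + 2                         ≡⟨ arith₁ ∑P ∑H ⟩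
      (∑P + 1) + (∑H + 1)                 ≡⟨ cong₂ _+_ ∑P+1 ∑H+1 ⟩
      (m * 1 + 2) + (m * 1 + 0)           ≡⟨ cong (λ k → (k * 1 + 2) + (k * 1 + 0)) (sym 1+[m-1]≡m) ⟩
      (suc m-1 * 1 + 2) + (suc m-1 * 1 + 0) ≡⟨ arith₂ m-1 ⟩
      ρH + 2                              ∎)
      where
      open ≡-Reasoning
      ∑P = ∑[ u < m ] w v u
      ∑H = ∑[ i < m ] w v (m + i)
      ∑P+1 : ∑P + 1 ≡ m * 1 + 2
      ∑P+1 = trans (∑<-except 0 0<m (λ i i<m i≢0 → weight-¬Adj adj?
                      (λ i≡v → <⇒≱ i<m (subst (m ≤_) (sym i≡v) m≤v))
                      (¬Adj-PH (n≢0⇒n>0 i≢0) i<m m≤v v<2m)))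
                   (cong (m * 1 +_) (weight-Adj adj? (Adj-0H m≤v v<2m)))
      v∸m<m : v ∸ m < m
      v∸m<m = subst (v ∸ m <_) (m+n∸m≡n m m) (∸-monoˡ-< v<2m m≤v)
      ∑H+1 : ∑H + 1 ≡ m * 1 + 0
      ∑H+1 = trans (∑<-except (v ∸ m) v∸m<m (λ i i<m i≢v∸m → weight-¬Adj adj?
                      (λ m+i≡v → i≢v∸m (trans (sym (m+n∸m≡n m i)) (cong (_∸ m) m+i≡v)))
                      (¬Adj-HH (m≤m+n m i) (+-monoʳ-< m i<m) m≤v v<2m)))
                   (cong (m * 1 +_) (trans (cong (w v) (m+[n∸m]≡n m≤v)) (weight-self adj? v)))
      arith₁ : ∀ a b → a + b + 2 ≡ (a + 1) + (b + 1)
      arith₁ = solve-∀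
      arith₂ : ∀ k → (suc k * 1 + 2) + (suc k * 1 + 0) ≡ (2 + 2 * k) + 2
      arith₂ = solve-∀

    rs≡½ : ∀ {v ρ} → v < m + m → ∑[ u < m + m ] w v u ≡ ρ → rs n d v ≡ ½ ρ
    rs≡½ {v} v<2m ∑≡ρ = trans (rs≡½∑weight adj? isD Adj-0 (Vertex-m+m v<2m))
                              (cong ½ (trans (cong (λ k → ∑< k (w v)) 2ⁿ≡m+m) ∑≡ρ))

    rs-0 : rs n d 0 ≡ ½ ρ₀
    rs-0 = rs≡½ (m≤n⇒m≤n+o m 0<m) ∑w-0

    rs-P : ∀ {v} → 0 < v → v < m → rs n d v ≡ ½ ρP
    rs-P 0<v v<m = rs≡½ (m≤n⇒m≤n+o m v<m) (∑w-P 0<v v<m)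

    rs-H : ∀ {v} → m ≤ v → v < m + m → rs n d v ≡ ½ ρH
    rs-H m≤v v<2m = rs≡½ v<2m (∑w-H m≤v v<2m)

    module Coefficient (e : ℚ) where

      column : ℕ → ℕ
      column v = ∑[ u < m + m ] coeff (edgeTerm adj? d u v) e

      coeff-edge : ∀ {u v q₁ q₂} → u < v → Adj n u v → rs n d u ≡ q₁ → rs n d v ≡ q₂ →
                   coeff (edgeTerm adj? d u v) e ≡ coeff (x^ (q₁ +ℚ q₂)) e
      coeff-edge u<v adj rsu rsv =
        cong (λ p → coeff p e) (trans (edgeTerm-Adj adj? d u<v adj) (cong₂ (λ q₁ q₂ → x^ (q₁ +ℚ q₂)) rsu rsv))

      coeff-nonedge : ∀ {u v} → ¬ Adj n u v → coeff (edgeTerm adj? d u v) e ≡ 0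
      coeff-nonedge ¬adj = cong (λ p → coeff p e) (edgeTerm-¬Adj adj? d ¬adj)

      column≡∑below : ∀ {v} → v ≤ m + m → column v ≡ ∑[ u < v ] coeff (edgeTerm adj? d u v) e
      column≡∑below v≤2m = ∑<-truncate _ v≤2m (λ u v≤u _ → cong (λ p → coeff p e) (edgeTerm-≥ adj? d (≤⇒≯ v≤u)))

      a b c : ℕ
      a = coeff (x^ (½ ρ₀ +ℚ ½ ρP)) e
      b = coeff (x^ (½ ρP +ℚ ½ ρP)) e
      c = coeff (x^ (½ ρ₀ +ℚ ½ ρH)) e

      column-P : ∀ {v} → suc v < m → column (suc v) ≡ a + v * b
      column-P {v} 1+v<m = begin
        column (suc v)                                                ≡⟨ column≡∑below (<⇒≤ (m≤n⇒m≤n+o m 1+v<m)) ⟩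
        coeff (edgeTerm adj? d 0 (suc v)) e + ∑[ i < v ] coeff (edgeTerm adj? d (suc i) (suc v)) e
          ≡⟨ cong₂ _+_ (coeff-edge z<s (Adj-PP 0<m 1+v<m (λ ())) rs-0 (rs-P z<s 1+v<m)) (∑<-const v edge-P) ⟩
        a + v * b                                                     ∎
        where
        open ≡-Reasoning
        edge-P : ∀ i → i < v → coeff (edgeTerm adj? d (suc i) (suc v)) e ≡ b
        edge-P i i<v = coeff-edge (s<s i<v) (Adj-PP 1+i<m 1+v<m (<⇒≢ (s<s i<v))) (rs-P z<s 1+i<m) (rs-P z<s 1+v<m)
          where
          1+i<m = <-trans (s<s i<v) 1+v<m

      column-H : ∀ {v} → m ≤ v → v < m + m → column v ≡ c
      column-H {v} m≤v v<2m = begin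
        column v                                                ≡⟨ sym (+-identityʳ (column v)) ⟩
        column v + 0                                            ≡⟨ cong (_+ 0) (column≡∑below (<⇒≤ v<2m)) ⟩
        ∑[ u < v ] coeff (edgeTerm adj? d u v) e + 0            ≡⟨ ∑<-except 0 0<v nonedge ⟩
        v * 0 + coeff (edgeTerm adj? d 0 v) e                    ≡⟨ cong₂ _+_ (*-zeroʳ v) (coeff-edge 0<v (Adj-0H m≤v v<2m) rs-0 (rs-H m≤v v<2m)) ⟩
        c                                                       ∎
        where
        open ≡-Reasoning
        0<v = <-≤-trans 0<m m≤v
        nonedge : ∀ u → u < v → u ≢ 0 → coeff (edgeTerm adj? d u v) e ≡ 0
        nonedge u u<v u≢0 with u <? m
        ... | yes u<m = coeff-nonedge (¬Adj-PH (n≢0⇒n>0 u≢0) u<m m≤v v<2m)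
        ... | no u≮m  = coeff-nonedge (¬Adj-HH (≮⇒≥ u≮m) (<-trans u<v v<2m) m≤v v<2m)

      column-0 : column 0 ≡ 0
      column-0 = column≡∑below z≤n

      coeff-edgePolynomial : coeff edgePolynomial e ≡ m-1 * a + (m * c + ((m-1 C 2) * b + 0))
      coeff-edgePolynomial =
        trans (coeff-∷ m-1 (½ ρ₀ +ℚ ½ ρP) (p₂ ∷ p₃ ∷ []) e) (cong (m-1 * a +_)
        (trans (coeff-∷ m (½ ρ₀ +ℚ ½ ρH) (p₃ ∷ []) e) (cong (m * c +_)
        (coeff-∷ (m-1 C 2) (½ ρP +ℚ ½ ρP) [] e))))
        where
        p₂ = (m , ½ ρ₀ +ℚ ½ ρH)
        p₃ = (m-1 C 2 , ½ ρP +ℚ ½ ρP)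

      ∑column-P : ∑[ v < m ] column v ≡ m-1 * a + (m-1 C 2) * b
      ∑column-P = begin
        ∑[ v < m ] column v                        ≡⟨ cong (λ k → ∑< k column) (sym 1+[m-1]≡m) ⟩
        column 0 + ∑[ v < m-1 ] column (suc v)     ≡⟨ cong₂ _+_ column-0 (∑<-cong m-1 λ v v<m-1 →
                                                        column-P (subst (suc v <_) 1+[m-1]≡m (s<s v<m-1))) ⟩
        ∑[ v < m-1 ] (a + v * b)                   ≡⟨ ∑<-arithmetic m-1 a b ⟩
        m-1 * a + (m-1 C 2) * b                    ∎
        where open ≡-Reasoning

      ∑column-H : ∑[ i < m ] column (m + i) ≡ m * c
      ∑column-H = ∑<-const m (λ i i<m → column-H (m≤m+n m i) (+-monoʳ-< m i<m))

      ∑column : ∑[ v < m + m ] column v ≡ coeff edgePolynomial e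
      ∑column = begin
        ∑[ v < m + m ] column v                               ≡⟨ ∑<-+ m m column ⟩
        ∑[ v < m ] column v + ∑[ i < m ] column (m + i)         ≡⟨ cong₂ _+_ ∑column-P ∑column-H ⟩
        (m-1 * a + (m-1 C 2) * b) + m * c                     ≡⟨ arith (m-1 * a) ((m-1 C 2) * b) (m * c) ⟩
        m-1 * a + (m * c + ((m-1 C 2) * b + 0))               ≡⟨ coeff-edgePolynomial ⟨
        coeff edgePolynomial e                                ∎
        where
        open ≡-Reasoning
        arith : ∀ x y z → (x + y) + z ≡ x + (z + (y + 0))
        arith = solve-∀

    Hrs≈edgePolynomial : Hrs n adj? d ≈P edgePolynomial
    Hrs≈edgePolynomial e = begin
      coeff (Hrs n adj? d) e                                        ≡⟨ coeff-Hrs adj? d e ⟩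
      ∑[ v < 2 ^ n ] ∑[ u < 2 ^ n ] coeff (edgeTerm adj? d u v) e   ≡⟨ cong (λ k → ∑[ v < k ] ∑[ u < k ] coeff (edgeTerm adj? d u v) e) 2ⁿ≡m+m ⟩
      ∑[ v < m + m ] column v                                       ≡⟨ ∑column ⟩
      coeff edgePolynomial e                                        ∎
      where
      open ≡-Reasoning
      open Coefficient e

lemma4p3 : (n : ℕ) → 3 ≤ n →
    (adj? : ∀ u v → Dec (Adj n u v)) →
    (d : ℕ → ℕ → ℕ) → IsDistance n d →
    Hrs n adj? d ≈P HrsFormula n
lemma4p3 n@(suc (suc (suc r))) (s≤s (s≤s (s≤s _))) adj? d isD e = begin
  coeff (Hrs n adj? d) e       ≡⟨ Hrs≈edgePolynomial e ⟩
  coeff edgePolynomial e       ≡⟨ cong (λ p → coeff p e) HrsFormula≡edgePolynomial ⟨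
  coeff (HrsFormula n) e       ∎
  where
  open ≡-Reasoning
  open Gyrogroup (suc r) hiding (n)
  open Status adj? isD
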